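{- For every connected weighted graph $(G,\mathbf{w})$: (1) $c_{\lambda}(G,\mathbf{w}) \geq \lambda\, \mathrm{diam}_\mathbf{w}(G)$ for every positive integer $\lambda$; (2) $c_{\lambda}(G,\mathbf{w}) \leq 2\lambda\, \mathrm{diam}_\mathbf{w}(G)$ for some sufficiently large positive integer $\lambda$.
   Context: A weighted graph $(G,\mathbf{w})$ is a finite simple graph with positive integer edge weights that is weight-minimal: every edge is a shortest path between its endpoints. $d_\mathbf{w}(u,v)$ is the minimum total weight of a $(u,v)$-path and $\mathrm{diam}_\mathbf{w}(G)=\max_{u,v}d_\mathbf{w}(u,v)$. For a positive integer $\lambda$, $c_\lambda(G,\mathbf{w})$ is the minimum $m$ such that there is $f:V(G)\to\{0,1\}^m$ with $\lambda\, d_\mathbf{w}(u,v)\le d_H(f(u),f(v))$ for all $u,v\in V(G)$, where $d_H$ is Hamming distance. -}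

module Defs where

open import Data.Nat using (ℕ; zero; suc; _+_; _*_; _≤_; _<_)
open import Data.Bool using (Bool; true; false; _≟_)
open import Data.Fin using (Fin)
open import Data.Vec using (Vec; []; _∷_)
open import Data.Product using (Σ; _×_; ∃; ∃-syntax)
open import Relation.Binary.PropositionalEquality using (_≡_)
open import Relation.Nullary using (¬_; yes; no)

-- A finite simple graph on vertex set Fin n with edge weights.
-- adj is a symmetric irreflexive Boolean adjacency relation; w u v is the
-- weight of edge uv (values off the edge set are irrelevant).
record WGraph (n : ℕ) : Set where
  field
    adj      : Fin n → Fin n → Bool
    adj-sym  : ∀ u v → adj u v ≡ adj v u
    adj-irr  : ∀ u → adj u u ≡ false
    w        : Fin n → Fin n → ℕ
    w-sym    : ∀ u v → adj u v ≡ true → w u v ≡ w v u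
    w-pos    : ∀ u v → adj u v ≡ true → 0 < w u v

module _ {n : ℕ} (G : WGraph n) where
  open WGraph G

  data Walk : Fin n → Fin n → Set where
    here : ∀ u → Walk u u
    step : ∀ {u v x} → adj u v ≡ true → Walk v x → Walk u x

  weight : ∀ {u v} → Walk u v → ℕ
  weight (here _) = 0
  weight (step {u} {v} _ p) = w u v + weight p

  IsDist : Fin n → Fin n → ℕ → Set
  IsDist u v d = (Σ (Walk u v) λ p → weight p ≡ d) × (∀ (p : Walk u v) → d ≤ weight p)

  Connected : Set
  Connected = ∀ u v → Walk u v

  WeightMinimal : Set
  WeightMinimal = ∀ u v → adj u v ≡ true → IsDist u v (w u v)

  IsDiam : ℕ → Set
  IsDiam D = (∃[ u ] ∃[ v ] IsDist u v D) × (∀ u v d → IsDist u v d → d ≤ D)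

hamming : ∀ {m} → Vec Bool m → Vec Bool m → ℕ
hamming [] [] = 0
hamming (a ∷ xs) (b ∷ ys) with a ≟ b
... | yes _ = hamming xs ys
... | no  _ = suc (hamming xs ys)

module _ {n : ℕ} (G : WGraph n) where
  Embeds : ℕ → ℕ → Set
  Embeds lam m = Σ (Fin n → Vec Bool m) λ f →
    ∀ u v d → IsDist G u v d → lam * d ≤ hamming (f u) (f v)

  IsCLambda : ℕ → ℕ → Set
  IsCLambda lam c = Embeds lam c × (∀ m → Embeds lam m → c ≤ m)

{-# OPTIONS --safe #-}
module Submission where

-- Lower bound: a diametral pair is sent to Hamming distance at least λD, and no
-- two words of {0,1}ᵐ are further than m apart.  Upper bound: with λ = 2ⁿ, send
-- vertex u to 2D copies of the dictator codeword x ↦ x u over {0,1}ⁿ; distinct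
-- dictators differ in exactly half of their 2ⁿ positions, so distinct vertices
-- land at distance at least 2ⁿD ≥ λ d in dimension 2λD.  Since c_λ is defined as
-- a least dimension, it must also be shown to exist: embeddability in a given
-- dimension is decidable by exhaustive search, distances being decidable because
-- edge weights are positive.

open import Defs
open import Data.Bool using (Bool; true; false)
import Data.Bool as Bool
open import Data.Fin using (Fin; zero; suc)
import Data.Fin as Fin
open import Data.Fin.Properties using (any?; all?)
open import Data.Fin.Subset.Properties using (anySubset?)
open import Data.Nat using (ℕ; zero; suc; _+_; _*_; _^_; _∸_; _≤_; _<_; z≤n; s≤s; _≤?_; _≟_)
open import Data.Nat.Induction using (<-rec)
open import Data.Nat.Properties
open import Data.Product using (_×_; ∃; ∃-syntax; Σ; _,_; proj₁; proj₂)
open import Data.Sum using (_⊎_; inj₁; inj₂)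
open import Data.Vec using (Vec; []; _∷_; _++_; concat; replicate; lookup; tabulate)
open import Data.Vec.Properties using (lookup∘tabulate)
open import Function using (_∘_; _⇔_; mk⇔)
open import Level using (0ℓ)
open import Relation.Binary.PropositionalEquality
open import Relation.Nullary using (¬_; Dec; yes; no; contradiction; ¬?; _×-dec_; _⊎-dec_; _→-dec_)
import Relation.Nullary.Decidable as Dec
open import Relation.Unary using (Pred; Decidable)

hamming≤length : ∀ {m} (x y : Vec Bool m) → hamming x y ≤ m
hamming≤length [] [] = z≤n
hamming≤length (a ∷ x) (b ∷ y) with a Bool.≟ b
... | yes _ = m≤n⇒m≤1+n (hamming≤length x y)
... | no _ = s≤s (hamming≤length x y)

hamming-comm : ∀ {m} (x y : Vec Bool m) → hamming x y ≡ hamming y x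
hamming-comm [] [] = refl
hamming-comm (false ∷ x) (false ∷ y) = hamming-comm x y
hamming-comm (false ∷ x) (true ∷ y) = cong suc (hamming-comm x y)
hamming-comm (true ∷ x) (false ∷ y) = cong suc (hamming-comm x y)
hamming-comm (true ∷ x) (true ∷ y) = hamming-comm x y

hamming-++ : ∀ {m k} (x y : Vec Bool m) (x′ y′ : Vec Bool k) →
             hamming (x ++ x′) (y ++ y′) ≡ hamming x y + hamming x′ y′
hamming-++ [] [] x′ y′ = refl
hamming-++ (a ∷ x) (b ∷ y) x′ y′ with a Bool.≟ b
... | yes _ = hamming-++ x y x′ y′
... | no _ = cong suc (hamming-++ x y x′ y′)

hamming-concat-replicate : ∀ {m} k (x y : Vec Bool m) →
  hamming (concat (replicate k x)) (concat (replicate k y)) ≡ k * hamming x y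
hamming-concat-replicate zero x y = refl
hamming-concat-replicate (suc k) x y = begin
  hamming (x ++ concat (replicate k x)) (y ++ concat (replicate k y))
    ≡⟨ hamming-++ x y _ _ ⟩
  hamming x y + hamming (concat (replicate k x)) (concat (replicate k y))
    ≡⟨ cong (hamming x y +_) (hamming-concat-replicate k x y) ⟩
  hamming x y + k * hamming x y ∎
  where open ≡-Reasoning

hamming-false+hamming-true : ∀ {m} (x : Vec Bool m) →
  hamming (replicate m false) x + hamming (replicate m true) x ≡ m
hamming-false+hamming-true [] = refl
hamming-false+hamming-true {suc m} (false ∷ x) = begin
  hamming (replicate m false) x + suc (hamming (replicate m true) x)
    ≡⟨ +-suc _ _ ⟩
  suc (hamming (replicate m false) x + hamming (replicate m true) x)
    ≡⟨ cong suc (hamming-false+hamming-true x) ⟩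
  suc m ∎
  where open ≡-Reasoning
hamming-false+hamming-true (true ∷ x) = cong suc (hamming-false+hamming-true x)

-- The coordinate x ↦ x u, tabulated over all x ∈ {0,1}ⁿ.
dictator : ∀ {n} → Fin n → Vec Bool (2 ^ n)
dictator {suc n} zero = replicate (2 ^ n) false ++ (replicate (2 ^ n) true ++ [])
dictator (suc u) = dictator u ++ (dictator u ++ [])

hamming-dictator-zero-suc : ∀ {n} (v : Fin n) →
  hamming (dictator {suc n} zero) (dictator (suc v)) ≡ 2 ^ n
hamming-dictator-zero-suc {n} v = begin
  hamming (F ++ (T ++ [])) (d ++ (d ++ []))
    ≡⟨ hamming-++ F d _ _ ⟩
  hamming F d + hamming (T ++ []) (d ++ [])
    ≡⟨ cong (hamming F d +_) (trans (hamming-++ T d [] []) (+-identityʳ _)) ⟩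
  hamming F d + hamming T d
    ≡⟨ hamming-false+hamming-true d ⟩
  2 ^ n ∎
  where
  open ≡-Reasoning
  F = replicate (2 ^ n) false
  T = replicate (2 ^ n) true
  d = dictator v

hamming-dictator-suc : ∀ {n} (u v : Fin n) →
  hamming (dictator (suc u)) (dictator (suc v)) ≡ 2 * hamming (dictator u) (dictator v)
hamming-dictator-suc u v = begin
  hamming (du ++ (du ++ [])) (dv ++ (dv ++ []))
    ≡⟨ hamming-++ du dv _ _ ⟩
  hamming du dv + hamming (du ++ []) (dv ++ [])
    ≡⟨ cong (hamming du dv +_) (hamming-++ du dv [] []) ⟩
  2 * hamming du dv ∎
  where
  open ≡-Reasoning
  du = dictator u
  dv = dictator v

dictator-separated : ∀ {n} {u v : Fin n} → u ≢ v →
  2 ^ n ≤ 2 * hamming (dictator u) (dictator v)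
dictator-separated {u = zero} {zero} u≢v = contradiction refl u≢v
dictator-separated {u = zero} {suc v} _ =
  ≤-reflexive (sym (cong (2 *_) (hamming-dictator-zero-suc v)))
dictator-separated {suc n} {suc u} {zero} _ =
  ≤-reflexive (sym (cong (2 *_) (trans (hamming-comm (dictator (suc u)) (dictator {suc n} zero))
                                     (hamming-dictator-zero-suc u))))
dictator-separated {suc n} {suc u} {suc v} u≢v = begin
  2 * 2 ^ n                                   ≤⟨ *-monoʳ-≤ 2 (dictator-separated (u≢v ∘ cong suc)) ⟩
  2 * (2 * hamming (dictator u) (dictator v)) ≡⟨ cong (2 *_) (hamming-dictator-suc u v) ⟨
  2 * hamming (dictator (suc u)) (dictator (suc v)) ∎
  where open ≤-Reasoning

Searchable : Set → Set₁
Searchable A = ∀ {P : Pred A 0ℓ} → Decidable P → Dec (∃ P)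

searchVec : ∀ {A} → Searchable A → ∀ k → Searchable (Vec A k)
searchVec search zero P? = Dec.map′ ([] ,_) (λ { ([] , p) → p }) (P? [])
searchVec search (suc k) P? =
  Dec.map′ (λ { (a , xs , p) → a ∷ xs , p }) (λ { (a ∷ xs , p) → a , xs , p })
           (search λ a → searchVec search k (P? ∘ (a ∷_)))

searchFin→ : ∀ {A n} → Searchable A → {P : Pred (Fin n → A) 0ℓ} →
             (∀ {f g} → f ≗ g → P f → P g) → Decidable P → Dec (∃ P)
searchFin→ {n = n} search resp P? =
  Dec.map′ (λ (xs , p) → lookup xs , p)
           (λ (f , p) → tabulate f , resp (sym ∘ lookup∘tabulate f) p)
           (searchVec search n (P? ∘ lookup))

Least : Pred ℕ 0ℓ → Set
Least P = ∃ λ c → P c × (∀ m → P m → c ≤ m)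

least : ∀ {P : Pred ℕ 0ℓ} → Decidable P → ∀ M → P M → Least P
least {P} P? = <-rec (λ M → P M → Least P) descend
  where
  descend : ∀ M → (∀ {M′} → M′ < M → P M′ → Least P) → P M → Least P
  descend M rec pM with anyUpTo? P? M
  ... | yes (M′ , M′<M , pM′) = rec M′<M pM′
  ... | no nothing-below = M , pM , λ m pm → ≮⇒≥ λ m<M → nothing-below (m , m<M , pm)

allBounded? : ∀ {P Q : Pred ℕ 0ℓ} → Decidable P → Decidable Q →
              ∀ D → (∀ d → P d → d ≤ D) → Dec (∀ d → P d → Q d)
allBounded? P? Q? D bounded =
  Dec.map′ (λ h d pd → h (s≤s (bounded d pd)) pd) (λ h {d} _ → h d)
           (allUpTo? (λ d → P? d →-dec Q? d) (suc D))

module _ {n} (G : WGraph n) where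
  open WGraph G

  HasWalk : Fin n → Fin n → ℕ → Set
  HasWalk u v e = Σ (Walk G u v) λ p → weight G p ≡ e

  FirstStep : ℕ → Fin n → Fin n → Fin n → Set
  FirstStep e u v x = Σ (adj u x ≡ true) λ _ → Σ (w u x ≤ e) λ _ → HasWalk x v (e ∸ w u x)

  hasWalk-unfold : ∀ {e u v} → ((u ≡ v × e ≡ 0) ⊎ ∃ (FirstStep e u v)) ⇔ HasWalk u v e
  hasWalk-unfold {e} {u} {v} = mk⇔ join split
    where
    split : HasWalk u v e → (u ≡ v × e ≡ 0) ⊎ ∃ (FirstStep e u v)
    split (here _ , refl) = inj₁ (refl , refl)
    split (step {v = x} a p , refl) =
      inj₂ (x , a , m≤m+n (w u x) (weight G p) , p , sym (m+n∸m≡n (w u x) (weight G p)))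
    join : (u ≡ v × e ≡ 0) ⊎ ∃ (FirstStep e u v) → HasWalk u v e
    join (inj₁ (refl , refl)) = here u , refl
    join (inj₂ (x , a , l , p , eq)) = step a p , trans (cong (w u x +_) eq) (m+[n∸m]≡n l)

  -- The remaining weight e ∸ w u x drops below e because edge weights are positive.
  hasWalk? : ∀ e u v → Dec (HasWalk u v e)
  hasWalk? = <-rec (λ e → ∀ u v → Dec (HasWalk u v e)) λ e rec u v →
    Dec.map hasWalk-unfold
            ((u Fin.≟ v ×-dec e ≟ 0) ⊎-dec any? (firstStep? e rec u v))
    where
    firstStep? : ∀ e → (∀ {e′} → e′ < e → ∀ u v → Dec (HasWalk u v e′)) →
                 ∀ u v x → Dec (FirstStep e u v x)
    firstStep? e rec u v x with adj u x Bool.≟ true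
    ... | no ¬a = no (¬a ∘ proj₁)
    ... | yes a with w u x ≤? e
    ...   | no ¬l = no (¬l ∘ proj₁ ∘ proj₂)
    ...   | yes l = Dec.map′ (λ r → a , l , r) (proj₂ ∘ proj₂)
                             (rec (∸-monoʳ-< (w-pos u x a) l) x v)

  isDist? : ∀ u v d → Dec (IsDist G u v d)
  isDist? u v d = Dec.map′ to from
    (hasWalk? d u v ×-dec allUpTo? (λ e → ¬? (hasWalk? e u v)) d)
    where
    to : HasWalk u v d × (∀ {e} → e < d → ¬ HasWalk u v e) → IsDist G u v d
    to (walk , none-shorter) = walk , λ p → ≮⇒≥ λ lt → none-shorter lt (p , refl)
    from : IsDist G u v d → HasWalk u v d × (∀ {e} → e < d → ¬ HasWalk u v e)
    from (walk , minimal) = walk , λ { e<d (p , refl) → <⇒≱ e<d (minimal p) }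

  DiamBound : ℕ → Set
  DiamBound D = ∀ u v d → IsDist G u v d → d ≤ D

  embeds? : ∀ {D} → DiamBound D → ∀ lam m → Dec (Embeds G lam m)
  embeds? {D} bounded lam m = searchFin→ (anySubset? {n = m}) respects good?
    where
    Good : Pred (Fin n → Vec Bool m) 0ℓ
    Good f = ∀ u v d → IsDist G u v d → lam * d ≤ hamming (f u) (f v)
    respects : ∀ {f g} → f ≗ g → Good f → Good g
    respects f≗g good u v d dist =
      subst₂ (λ x y → lam * d ≤ hamming x y) (f≗g u) (f≗g v) (good u v d dist)
    good? : Decidable Good
    good? f = all? λ u → all? λ v →
      allBounded? (isDist? u v) (λ d → lam * d ≤? hamming (f u) (f v)) D (bounded u v)

  cLambda-exists : ∀ {D} → DiamBound D → ∀ {lam M} → Embeds G lam M →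
                   ∃[ c ] (IsCLambda G lam c × c ≤ M)
  cLambda-exists bounded {lam} {M} emb with least (embeds? bounded lam) M emb
  ... | c , embeds , minimal = c , (embeds , minimal) , minimal M emb

  embeds⇒≤ : ∀ {u v d lam m} → IsDist G u v d → Embeds G lam m → lam * d ≤ m
  embeds⇒≤ {u} {v} {d} dist (f , embeds) =
    ≤-trans (embeds u v d dist) (hamming≤length (f u) (f v))

  isDist-self : ∀ {u d} → IsDist G u u d → d ≡ 0
  isDist-self {u} (_ , minimal) = n≤0⇒n≡0 (minimal (here u))

  embeds-dictator : ∀ {D} → DiamBound D → Embeds G (2 ^ n) (2 * D * 2 ^ n)
  embeds-dictator {D} bounded = f , separated
    where
    f : Fin n → Vec Bool (2 * D * 2 ^ n)
    f u = concat (replicate (2 * D) (dictator u))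
    separated : ∀ u v d → IsDist G u v d → 2 ^ n * d ≤ hamming (f u) (f v)
    separated u v d dist with u Fin.≟ v
    ... | yes refl rewrite isDist-self dist | *-zeroʳ (2 ^ n) = z≤n
    ... | no u≢v = begin
      2 ^ n * d           ≤⟨ *-monoʳ-≤ (2 ^ n) (bounded u v d dist) ⟩
      2 ^ n * D           ≡⟨ *-comm (2 ^ n) D ⟩
      D * 2 ^ n           ≤⟨ *-monoʳ-≤ D (dictator-separated u≢v) ⟩
      D * (2 * h)         ≡⟨ *-assoc D 2 h ⟨
      D * 2 * h           ≡⟨ cong (_* h) (*-comm D 2) ⟩
      2 * D * h           ≡⟨ hamming-concat-replicate (2 * D) (dictator u) (dictator v) ⟨
      hamming (f u) (f v) ∎
      where
      open ≤-Reasoning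
      h = hamming (dictator u) (dictator v)

theorem3 : ∀ {n} (G : WGraph n) → Connected G → WeightMinimal G →
    ∀ D → IsDiam G D →
      (∀ lam c → 0 < lam → IsCLambda G lam c → lam * D ≤ c)
      × (∃[ lam ] (0 < lam × ∃[ c ] (IsCLambda G lam c × c ≤ 2 * lam * D)))
theorem3 {n} G _ _ D ((u , v , diametral) , bounded) = lower , upper
  where
  lower : ∀ lam c → 0 < lam → IsCLambda G lam c → lam * D ≤ c
  lower lam c _ (embeds , _) = embeds⇒≤ G {lam = lam} diametral embeds
  length-≡ : 2 * D * 2 ^ n ≡ 2 * 2 ^ n * D
  length-≡ = begin
    2 * D * 2 ^ n   ≡⟨ *-assoc 2 D (2 ^ n) ⟩
    2 * (D * 2 ^ n) ≡⟨ cong (2 *_) (*-comm D (2 ^ n)) ⟩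
    2 * (2 ^ n * D) ≡⟨ *-assoc 2 (2 ^ n) D ⟨
    2 * 2 ^ n * D   ∎
    where open ≡-Reasoning
  upper : ∃[ lam ] (0 < lam × ∃[ c ] (IsCLambda G lam c × c ≤ 2 * lam * D))
  upper with cLambda-exists G bounded {lam = 2 ^ n} (embeds-dictator G bounded)
  ... | c , isC , c≤ = 2 ^ n , m^n>0 2 n , c , isC , ≤-trans c≤ (≤-reflexive length-≡)
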